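{- Let $M,N\geq 0$ and $k\geq 1$ be integers with $|M-N|\leq k$. The number of pairs $(u,v)$ of binary words such that $u$ and $v$ each contain exactly $M$ letters $1$ and exactly $N$ letters $0$, and $$-k<\sum_{j\leq s}(u_j-v_j)<k\quad\text{for all } s=1,\ldots,M+N,$$ is equal to $$\sum_{l\in\mathbb{Z}}\binom{M+N}{M-kl}\binom{M+N}{N-kl}(-1)^l .$$
   Context: A binary word is a finite word $u=u_1u_2\cdots u_n$ on the alphabet $\{0,1\}$. Binomial coefficients $\binom{n}{j}$ are $0$ when $j<0$ or $j>n$. -}

module Defs where

open import Data.Bool using (Bool; true; false)
open import Data.Nat as ℕ using (ℕ; suc)
open import Data.Nat.Combinatorics using (_C_)
open import Data.Integer as ℤ using (ℤ; +_; -[1+_]; -_; _-_; _<_; _<?_; ∣_∣)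
open import Data.List using (List; []; _∷_; map; concatMap; filter; length; take; zipWith; upTo; foldr; cartesianProduct)
open import Data.List.Relation.Unary.All using (All)
open import Data.List.Relation.Unary.All as All using (all?)
open import Data.Product using (_×_; _,_; proj₁; proj₂)
open import Data.Product.Properties using ()
open import Relation.Nullary.Decidable using (Dec; _×-dec_; yes; no)
open import Relation.Binary.PropositionalEquality using (_≡_)
open import Data.Bool.Properties using () renaming (_≟_ to _≟ᵇ_)
open import Relation.Unary using (Decidable)
open import Data.Nat.Properties using () renaming (_≟_ to _≟ℕ_)

-- A binary word is a list of letters; the letter 1 is `true`, 0 is `false`.
Word : Set
Word = List Bool

allWords : ℕ → List Word
allWords ℕ.zero = [] ∷ []
allWords (suc n) = concatMap (λ w → (false ∷ w) ∷ (true ∷ w) ∷ []) (allWords n)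

ones : Word → ℕ
ones w = length (filter (λ b → b ≟ᵇ true) w)

zeros : Word → ℕ
zeros w = length (filter (λ b → b ≟ᵇ false) w)

val : Bool → ℤ
val true = + 1
val false = + 0

sumℤ : List ℤ → ℤ
sumℤ = foldr ℤ._+_ (+ 0)

D : Word → Word → ℕ → ℤ
D u v s = sumℤ (zipWith (λ a b → val a - val b) (take s u) (take s v))

wordsWith : ℕ → ℕ → List Word
wordsWith M N = filter (λ w → (ones w ≟ℕ M) ×-dec (zeros w ≟ℕ N)) (allWords (M ℕ.+ N))

Bounded : ℕ → ℕ → Word → Word → Set
Bounded n k u v = All (λ s → (- (+ k) < D u v s) × (D u v s < + k)) (map suc (upTo n))

bounded? : ∀ n k → Decidable (λ (p : Word × Word) → Bounded n k (proj₁ p) (proj₂ p))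
bounded? n k (u , v) = all? (λ s → (- (+ k) <? D u v s) ×-dec (D u v s <? + k)) (map suc (upTo n))

countPairs : ℕ → ℕ → ℕ → ℕ
countPairs M N k =
  length (filter (bounded? (M ℕ.+ N) k) (cartesianProduct (wordsWith M N) (wordsWith M N)))

-- Binomial coefficient with integer lower index; 0 when j < 0 or j > n.
binomℤ : ℕ → ℤ → ℤ
binomℤ n (+ j) = + (n C j)
binomℤ n -[1+ _ ] = + 0

signℤ : ℤ → ℤ
signℤ l = (- (+ 1)) ℤ.^ ∣ l ∣

term : ℕ → ℕ → ℕ → ℤ → ℤ
term M N k l =
  binomℤ (M ℕ.+ N) (+ M - + k ℤ.* l) ℤ.* binomℤ (M ℕ.+ N) (+ N - + k ℤ.* l) ℤ.* signℤ l

symSum : ℕ → (ℤ → ℤ) → ℤ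
symSum L f = sumℤ (map (λ i → f (+ i - + L)) (upTo (suc (L ℕ.+ L))))

module Submission where

-- Proof by the reflection principle (method of images).
--
-- Generalise the count: pairCount n a b d is the number of pairs of words of
-- length n with a and b letters 1 whose difference walk, started at d, stays
-- in the band (-K, K).  Splitting on the first letters gives a four-term
-- recursion, in which steps that leave the band are discarded.  The image sum
-- Σ_{|j| ≤ R} [C(n,a-2Kj) C(n,b+2Kj) - C(n,b+K-d-2Kj) C(n,a-K+d+2Kj)]
-- satisfies the same recursion by Pascal's rule, and vanishes on the walls
-- d = K and d = -K because the reflections j ↦ -j and j ↦ 1-j exchange its
-- direct and mirrored terms.  For the empty word both sides are the indicator
-- of a = b = 0, so the two agree (Reflection.pairCount≡imageSum).  At a = b = M,
-- d = 0 the j-th image term is the sum of the terms l = 2j and l = 2j-1 of the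
-- alternating sum in the statement (Evaluation.imageSum-origin).

open import Data.Bool using (Bool; true; false; if_then_else_)
open import Data.Empty using (⊥; ⊥-elim)
open import Data.Integer as ℤ using (ℤ; +_; -[1+_]; _+_; _*_; _-_; -_; _<_; _≤_; _<?_; +≤+; +<+; -<+; ∣_∣)
import Data.Integer.Properties as ℤP
open import Data.Integer.Tactic.RingSolver using (solve-∀)
open import Data.List using (List; []; _∷_; map; applyUpTo; upTo; filter; length; cartesianProduct; _++_; concatMap)
open import Data.List.Relation.Unary.All as All using (All; _∷_; all?)
import Data.List.Relation.Unary.All.Properties as AllP
open import Data.Nat as ℕ using (ℕ; zero; suc; z≤n; s≤s; _≤′_; ≤′-refl; ≤′-step; _⊔_; _∸_)
import Data.Nat.Properties as ℕP
open import Data.Nat.Combinatorics using (_C_; nCk+nC[k+1]≡[n+1]C[k+1]; k>n⇒nCk≡0; nCk≡nC[n∸k])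
open import Data.Product using (_×_; _,_; proj₁; proj₂)
open import Relation.Nullary using (Dec; yes; no; does; ¬_)
open import Relation.Nullary.Decidable using (_×-dec_)
open import Relation.Unary using (Decidable)
open import Relation.Binary.PropositionalEquality
open import Function.Bundles using (_⇔_; mk⇔; Equivalence)
open import Defs

-- symΣ L f = f (-L) + ⋯ + f L, built from the centre outwards, so that
-- reflecting (l ↦ -l) and shifting (l ↦ l + 1) the index are easy inductions.
symΣ : ℕ → (ℤ → ℤ) → ℤ
symΣ zero f = f (+ 0)
symΣ (suc L) f = f -[1+ L ] + symΣ L f + f (+ suc L)

sumBelow : ℕ → (ℕ → ℤ) → ℤ
sumBelow zero g = + 0
sumBelow (suc m) g = g 0 + sumBelow m (λ i → g (suc i))

sumℤ-applyUpTo : ∀ (g : ℕ → ℤ) f m → sumℤ (map g (applyUpTo f m)) ≡ sumBelow m (λ i → g (f i))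
sumℤ-applyUpTo g f zero = refl
sumℤ-applyUpTo g f (suc m) = cong (λ s → g (f 0) + s) (sumℤ-applyUpTo g (λ i → f (suc i)) m)

sumBelow-cong : ∀ m {g h : ℕ → ℤ} → (∀ i → g i ≡ h i) → sumBelow m g ≡ sumBelow m h
sumBelow-cong zero eq = refl
sumBelow-cong (suc m) eq = cong₂ _+_ (eq 0) (sumBelow-cong m (λ i → eq (suc i)))

sumBelow-last : ∀ m (g : ℕ → ℤ) → sumBelow (suc m) g ≡ sumBelow m g + g m
sumBelow-last zero g = trans (ℤP.+-identityʳ (g 0)) (sym (ℤP.+-identityˡ (g 0)))
sumBelow-last (suc m) g =
  trans (cong (λ s → g 0 + s) (sumBelow-last m (λ i → g (suc i)))) (sym (ℤP.+-assoc (g 0) _ _))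

sumBelow-symΣ : ∀ L (f : ℤ → ℤ) → sumBelow (suc (L ℕ.+ L)) (λ i → f (+ i - + L)) ≡ symΣ L f
sumBelow-symΣ zero f = ℤP.+-identityʳ (f (+ 0))
sumBelow-symΣ (suc L) f = begin
    sumBelow (suc (suc L ℕ.+ suc L)) h
  ≡⟨ cong (λ m → sumBelow (suc (suc m)) h) (ℕP.+-suc L L) ⟩
    h 0 + sumBelow (suc (suc (L ℕ.+ L))) (λ i → h (suc i))
  ≡⟨ cong (λ s → h 0 + s) (sumBelow-last (suc (L ℕ.+ L)) (λ i → h (suc i))) ⟩
    h 0 + (sumBelow (suc (L ℕ.+ L)) (λ i → h (suc i)) + h (suc (suc (L ℕ.+ L))))
  ≡⟨ cong₂ (λ u v → h 0 + (u + v))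
       (trans (sumBelow-cong (suc (L ℕ.+ L)) (λ i → cong f (index-shift i))) (sumBelow-symΣ L f))
       (cong f (last-index (+ L))) ⟩
    f -[1+ L ] + (symΣ L f + f (+ suc L))
  ≡⟨ sym (ℤP.+-assoc (f -[1+ L ]) (symΣ L f) (f (+ suc L))) ⟩
    symΣ (suc L) f ∎
  where
  open ≡-Reasoning
  h : ℕ → ℤ
  h i = f (+ i - + suc L)
  index-shift : ∀ i → + suc i - + suc L ≡ + i - + L
  index-shift i = trans (ℤP.m-n≡m⊖n (suc i) (suc L))
    (trans (ℤP.[1+m]⊖[1+n]≡m⊖n i L) (sym (ℤP.m-n≡m⊖n i L)))
  last-index : ∀ (x : ℤ) → (+ 1 + (+ 1 + (x + x))) - (+ 1 + x) ≡ + 1 + x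
  last-index = solve-∀

symSum≡symΣ : ∀ L f → symSum L f ≡ symΣ L f
symSum≡symΣ L f =
  trans (sumℤ-applyUpTo (λ i → f (+ i - + L)) (λ i → i) (suc (L ℕ.+ L))) (sumBelow-symΣ L f)

symΣ-cong : ∀ L {f g : ℤ → ℤ} → (∀ l → f l ≡ g l) → symΣ L f ≡ symΣ L g
symΣ-cong zero eq = eq (+ 0)
symΣ-cong (suc L) eq = cong₂ _+_ (cong₂ _+_ (eq _) (symΣ-cong L eq)) (eq _)

symΣ-+ : ∀ L (f g : ℤ → ℤ) → symΣ L (λ l → f l + g l) ≡ symΣ L f + symΣ L g
symΣ-+ zero f g = refl
symΣ-+ (suc L) f g =
  trans (cong (λ s → f -[1+ L ] + g -[1+ L ] + s + (f (+ suc L) + g (+ suc L))) (symΣ-+ L f g))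
        (regroup (f -[1+ L ]) (symΣ L f) (f (+ suc L)) (g -[1+ L ]) (symΣ L g) (g (+ suc L)))
  where
  regroup : ∀ (a b c d e f : ℤ) → (a + d) + (b + e) + (c + f) ≡ (a + b + c) + (d + e + f)
  regroup = solve-∀

symΣ-- : ∀ L (f g : ℤ → ℤ) → symΣ L (λ l → f l - g l) ≡ symΣ L f - symΣ L g
symΣ-- zero f g = refl
symΣ-- (suc L) f g =
  trans (cong (λ s → f -[1+ L ] - g -[1+ L ] + s + (f (+ suc L) - g (+ suc L))) (symΣ-- L f g))
        (regroup (f -[1+ L ]) (symΣ L f) (f (+ suc L)) (g -[1+ L ]) (symΣ L g) (g (+ suc L)))
  where
  regroup : ∀ (a b c d e f : ℤ) → (a - d) + (b - e) + (c - f) ≡ (a + b + c) - (d + e + f)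
  regroup = solve-∀

symΣ-reflect : ∀ L (f : ℤ → ℤ) → symΣ L (λ l → f (- l)) ≡ symΣ L f
symΣ-reflect zero f = refl
symΣ-reflect (suc L) f =
  trans (cong (λ s → f (+ suc L) + s + f -[1+ L ]) (symΣ-reflect L f))
        (swap (f (+ suc L)) (symΣ L f) (f -[1+ L ]))
  where
  swap : ∀ (a b c : ℤ) → a + b + c ≡ c + b + a
  swap = solve-∀

symΣ-shift : ∀ L (f : ℤ → ℤ) → symΣ L (λ l → f (l + + 1)) + f (- (+ L)) ≡ symΣ L f + f (+ suc L)
symΣ-shift zero f = ℤP.+-comm (f (+ 1)) (f (+ 0))
symΣ-shift (suc L) f = begin
    (f (-[1+ L ] + + 1) + S' + f (+ suc L + + 1)) + f -[1+ L ]
  ≡⟨ cong₂ (λ u v → (f u + S' + f v) + f -[1+ L ]) (left-end (+ L)) (right-end (+ L)) ⟩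
    (f (- (+ L)) + S' + f (+ suc (suc L))) + f -[1+ L ]
  ≡⟨ regroup (f (- (+ L))) S' (f (+ suc (suc L))) (f -[1+ L ]) ⟩
    f -[1+ L ] + (S' + f (- (+ L))) + f (+ suc (suc L))
  ≡⟨ cong (λ s → f -[1+ L ] + s + f (+ suc (suc L))) (symΣ-shift L f) ⟩
    f -[1+ L ] + (symΣ L f + f (+ suc L)) + f (+ suc (suc L))
  ≡⟨ cong (_+ f (+ suc (suc L))) (sym (ℤP.+-assoc (f -[1+ L ]) (symΣ L f) (f (+ suc L)))) ⟩
    symΣ (suc L) f + f (+ suc (suc L)) ∎
  where
  open ≡-Reasoning
  S' = symΣ L (λ l → f (l + + 1))
  left-end : ∀ (x : ℤ) → - (+ 1 + x) + + 1 ≡ - x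
  left-end = solve-∀
  right-end : ∀ (x : ℤ) → (+ 1 + x) + + 1 ≡ + 1 + (+ 1 + x)
  right-end = solve-∀
  regroup : ∀ (a b c d : ℤ) → (a + b + c) + d ≡ d + (b + a) + c
  regroup = solve-∀

symΣ-shift-invariant : ∀ L (f : ℤ → ℤ) → f (- (+ L)) ≡ + 0 → f (+ suc L) ≡ + 0 →
  symΣ L (λ l → f (l + + 1)) ≡ symΣ L f
symΣ-shift-invariant L f left right = begin
    symΣ L (λ l → f (l + + 1))
  ≡⟨ sym (ℤP.+-identityʳ _) ⟩
    symΣ L (λ l → f (l + + 1)) + + 0
  ≡⟨ cong (λ z → symΣ L (λ l → f (l + + 1)) + z) (sym left) ⟩
    symΣ L (λ l → f (l + + 1)) + f (- (+ L))
  ≡⟨ symΣ-shift L f ⟩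
    symΣ L f + f (+ suc L)
  ≡⟨ cong (λ z → symΣ L f + z) right ⟩
    symΣ L f + + 0
  ≡⟨ ℤP.+-identityʳ (symΣ L f) ⟩
    symΣ L f ∎
  where open ≡-Reasoning

symΣ-support : ∀ {L} L' (f : ℤ → ℤ) → L ℕ.≤ L' →
  (∀ m → L ℕ.≤ m → f -[1+ m ] ≡ + 0) → (∀ m → L ℕ.≤ m → f (+ suc m) ≡ + 0) →
  symΣ L' f ≡ symΣ L f
symΣ-support {L} L' f L≤L' vanish⁻ vanish⁺ = go (ℕP.≤⇒≤′ L≤L')
  where
  go : ∀ {L'} → L ≤′ L' → symΣ L' f ≡ symΣ L f
  go ≤′-refl = refl
  go (≤′-step {L'} p) = begin
      f -[1+ L' ] + symΣ L' f + f (+ suc L')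
    ≡⟨ cong₂ (λ u v → u + symΣ L' f + v) (vanish⁻ L' (ℕP.≤′⇒≤ p)) (vanish⁺ L' (ℕP.≤′⇒≤ p)) ⟩
      + 0 + symΣ L' f + + 0
    ≡⟨ trans (ℤP.+-identityʳ _) (ℤP.+-identityˡ _) ⟩
      symΣ L' f
    ≡⟨ go p ⟩
      symΣ L f ∎
    where open ≡-Reasoning

symΣ-pairs : ∀ R (g : ℤ → ℤ) →
  symΣ (suc (R ℕ.+ R)) g ≡ symΣ R (λ j → g (+ 2 * j) + g (+ 2 * j - + 1)) + g (+ suc (R ℕ.+ R))
symΣ-pairs zero g = swap (g -[1+ 0 ]) (g (+ 0)) (g (+ 1))
  where
  swap : ∀ (a b c : ℤ) → a + b + c ≡ b + a + c
  swap = solve-∀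
symΣ-pairs (suc R) g = begin
    symΣ (suc (suc R ℕ.+ suc R)) g
  ≡⟨ cong (λ m → symΣ (suc (suc m)) g) (ℕP.+-suc R R) ⟩
    g₋₂ + (g₋₁ + symΣ (suc (R ℕ.+ R)) g + g₊₁) + g₊₂
  ≡⟨ cong (λ s → g₋₂ + (g₋₁ + s + g₊₁) + g₊₂) (symΣ-pairs R g) ⟩
    g₋₂ + (g₋₁ + (P + g₀) + g₊₁) + g₊₂
  ≡⟨ regroup g₋₂ g₋₁ P g₀ g₊₁ g₊₂ ⟩
    (g₋₁ + g₋₂) + P + (g₊₁ + g₀) + g₊₂
  ≡⟨ cong₂ (λ u v → u + P + v + g₊₂)
       (cong₂ _+_ (cong g (even⁻ (+ R))) (cong g (odd⁻ (+ R))))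
       (cong₂ _+_ (cong g (even⁺ (+ R))) (cong g (odd⁺ (+ R)))) ⟩
    symΣ (suc R) pair + g₊₂
  ≡⟨ cong (λ m → symΣ (suc R) pair + g (+ suc (suc m))) (sym (ℕP.+-suc R R)) ⟩
    symΣ (suc R) pair + g (+ suc (suc R ℕ.+ suc R)) ∎
  where
  open ≡-Reasoning
  pair : ℤ → ℤ
  pair j = g (+ 2 * j) + g (+ 2 * j - + 1)
  P = symΣ R pair
  g₀ = g (+ suc (R ℕ.+ R))
  g₋₁ = g -[1+ suc (R ℕ.+ R) ]
  g₋₂ = g -[1+ suc (suc (R ℕ.+ R)) ]
  g₊₁ = g (+ suc (suc (R ℕ.+ R)))
  g₊₂ = g (+ suc (suc (suc (R ℕ.+ R))))
  regroup : ∀ (a b c d e f : ℤ) → a + (b + (c + d) + e) + f ≡ (b + a) + c + (e + d) + f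
  regroup = solve-∀
  even⁻ : ∀ (x : ℤ) → - (+ 1 + (+ 1 + (x + x))) ≡ + 2 * (- (+ 1 + x))
  even⁻ = solve-∀
  odd⁻ : ∀ (x : ℤ) → - (+ 1 + (+ 1 + (+ 1 + (x + x)))) ≡ + 2 * (- (+ 1 + x)) - + 1
  odd⁻ = solve-∀
  even⁺ : ∀ (x : ℤ) → + 1 + (+ 1 + (x + x)) ≡ + 2 * (+ 1 + x)
  even⁺ = solve-∀
  odd⁺ : ∀ (x : ℤ) → + 1 + (x + x) ≡ + 2 * (+ 1 + x) - + 1
  odd⁺ = solve-∀


binomℤ-pascal : ∀ n p → binomℤ (suc n) p ≡ binomℤ n p + binomℤ n (p - + 1)
binomℤ-pascal n (+ zero) = refl
binomℤ-pascal n (+ suc i) =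
  cong +_ (trans (sym (nCk+nC[k+1]≡[n+1]C[k+1] n i)) (ℕP.+-comm (n C i) (n C suc i)))
binomℤ-pascal n -[1+ m ] = refl

sub-neg : ∀ {x y : ℤ} → x < y → x - y < + 0
sub-neg {x} {y} x<y = subst (x - y <_) (ℤP.+-inverseʳ y) (ℤP.+-monoˡ-< (- y) x<y)

binomℤ-neg : ∀ n p → p < + 0 → binomℤ n p ≡ + 0
binomℤ-neg n (+ m) (+<+ ())
binomℤ-neg n -[1+ m ] _ = refl

binomℤ-reflect : ∀ n p → binomℤ n (+ n - p) ≡ binomℤ n p
binomℤ-reflect n (+ i) with i ℕP.≤? n
... | yes i≤n = trans (cong (binomℤ n) (trans (ℤP.m-n≡m⊖n n i) (ℤP.≤-⊖ i≤n)))
                      (cong +_ (sym (nCk≡nC[n∸k] i≤n)))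
... | no i≰n = trans (binomℤ-neg n (+ n - + i) (sub-neg (+<+ (ℕP.≰⇒> i≰n))))
                     (cong +_ (sym (k>n⇒nCk≡0 (ℕP.≰⇒> i≰n))))
binomℤ-reflect n -[1+ i ] = cong +_ (k>n⇒nCk≡0 (ℕP.m<m+n n (s≤s z≤n)))

𝟙 : {P : Set} → Dec P → ℤ
𝟙 p = if does p then + 1 else + 0

𝟙-cong : {P Q : Set} → (P → Q) → (Q → P) → (p : Dec P) (q : Dec Q) → 𝟙 p ≡ 𝟙 q
𝟙-cong f g (yes x) (yes y) = refl
𝟙-cong f g (yes x) (no ¬y) = ⊥-elim (¬y (f x))
𝟙-cong f g (no ¬x) (yes y) = ⊥-elim (¬x (g y))
𝟙-cong f g (no ¬x) (no ¬y) = refl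

𝟙-× : {P Q : Set} → (p : Dec P) (q : Dec Q) → 𝟙 (p ×-dec q) ≡ 𝟙 p * 𝟙 q
𝟙-× (yes x) (yes y) = refl
𝟙-× (yes x) (no y) = refl
𝟙-× (no x) (yes y) = refl
𝟙-× (no x) (no y) = refl

binomℤ-zero : ∀ p → binomℤ 0 p ≡ 𝟙 (+ 0 ℤ.≟ p)
binomℤ-zero (+ zero) = refl
binomℤ-zero (+ suc i) = refl
binomℤ-zero -[1+ i ] = refl

-- Sums over the four pairs of first letters (x, y) of two words.
Σ² : (Bool → Bool → ℤ) → ℤ
Σ² h = (h false false + h false true) + (h true false + h true true)

Σ²-cong : ∀ {h h' : Bool → Bool → ℤ} → (∀ x y → h x y ≡ h' x y) → Σ² h ≡ Σ² h'
Σ²-cong eq =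
  cong₂ _+_ (cong₂ _+_ (eq false false) (eq false true)) (cong₂ _+_ (eq true false) (eq true true))

Σ²-- : ∀ (h h' : Bool → Bool → ℤ) → Σ² h - Σ² h' ≡ Σ² (λ x y → h x y - h' x y)
Σ²-- h h' = regroup (h false false) (h false true) (h true false) (h true true)
                    (h' false false) (h' false true) (h' true false) (h' true true)
  where
  regroup : ∀ (a b c d e f g i : ℤ) →
    (a + b) + (c + d) - ((e + f) + (g + i)) ≡ (a - e + (b - f)) + (c - g + (d - i))
  regroup = solve-∀

symΣ-Σ² : ∀ R (h : Bool → Bool → ℤ → ℤ) →
  symΣ R (λ j → Σ² (λ x y → h x y j)) ≡ Σ² (λ x y → symΣ R (h x y))
symΣ-Σ² R h = trans (symΣ-+ R _ _) (cong₂ _+_ (symΣ-+ R _ _) (symΣ-+ R _ _))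

-- T n p q = C(n, p) C(n, q): the number of pairs of words of length n with
-- p and q letters 1.
T : ℕ → ℤ → ℤ → ℤ
T n p q = binomℤ n p * binomℤ n q

T-comm : ∀ n p q → T n p q ≡ T n q p
T-comm n p q = ℤP.*-comm (binomℤ n p) (binomℤ n q)

T-negˡ : ∀ n p q → p < + 0 → T n p q ≡ + 0
T-negˡ n p q p<0 = cong (_* binomℤ n q) (binomℤ-neg n p p<0)

T-negʳ : ∀ n p q → q < + 0 → T n p q ≡ + 0
T-negʳ n p q q<0 = trans (cong (binomℤ n p *_) (binomℤ-neg n q q<0)) (ℤP.*-zeroʳ (binomℤ n p))

T-pascal : ∀ n p q → T (suc n) p q ≡ Σ² (λ x y → T n (p - val x) (q - val y))
T-pascal n p q = begin
    T (suc n) p q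
  ≡⟨ cong₂ _*_ (binomℤ-pascal n p) (binomℤ-pascal n q) ⟩
    (binomℤ n p + binomℤ n (p - + 1)) * (binomℤ n q + binomℤ n (q - + 1))
  ≡⟨ expand (binomℤ n p) (binomℤ n (p - + 1)) (binomℤ n q) (binomℤ n (q - + 1)) ⟩
    (T n p q + T n p (q - + 1)) + (T n (p - + 1) q + T n (p - + 1) (q - + 1))
  ≡⟨ sym (cong₂ (λ u v → (T n u v + T n u (q - + 1)) + (T n (p - + 1) v + T n (p - + 1) (q - + 1)))
                (ℤP.+-identityʳ p) (ℤP.+-identityʳ q)) ⟩
    Σ² (λ x y → T n (p - val x) (q - val y)) ∎
  where
  open ≡-Reasoning
  expand : ∀ (a b c d : ℤ) → (a + b) * (c + d) ≡ (a * c + a * d) + (b * c + b * d)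
  expand = solve-∀

T-zero : ∀ p q → (p ≡ + 0 → q ≡ + 0 → ⊥) → T 0 p q ≡ + 0
T-zero p q not-both rewrite binomℤ-zero p | binomℤ-zero q with + 0 ℤ.≟ p | + 0 ℤ.≟ q
... | yes p≡0 | yes q≡0 = ⊥-elim (not-both (sym p≡0) (sym q≡0))
... | yes _ | no _ = refl
... | no _ | yes _ = refl
... | no _ | no _ = refl

InWindow : ℤ → ℤ → Set
InWindow r z = - r < z × z < r

window-+ : ∀ {r s x y} → InWindow r x → InWindow s y → InWindow (r + s) (x + y)
window-+ {r} {s} (lx , ux) (ly , uy) =
  subst (_< _) (sym (ℤP.neg-distrib-+ r s)) (ℤP.+-mono-< lx ly) , ℤP.+-mono-< ux uy

window-neg : ∀ {r x} → InWindow r x → InWindow r (- x)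
window-neg {r} (l , u) = ℤP.neg-mono-< u , subst (- _ <_) (ℤP.neg-involutive r) (ℤP.neg-mono-< l)

window-widen : ∀ {r s x} → r ≤ s → InWindow r x → InWindow s x
window-widen r≤s (l , u) = ℤP.≤-<-trans (ℤP.neg-mono-≤ r≤s) l , ℤP.<-≤-trans u r≤s

multiple-window : ∀ w (i : ℤ) → InWindow (+ suc w) (+ suc w * i) → i ≡ + 0
multiple-window w (+ zero) _ = refl
multiple-window w (+ suc m) (_ , u) = ⊥-elim (ℤP.<-irrefl refl (ℤP.<-≤-trans u r≤ri))
  where
  r≤ri : + suc w ≤ + suc w * + suc m
  r≤ri = +≤+ (ℕP.m≤m*n (suc w) (suc m))
multiple-window w -[1+ m ] (l , _) = ⊥-elim (ℤP.<-irrefl refl (ℤP.<-≤-trans l ri≤-r))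
  where
  ri≤-r : + suc w * -[1+ m ] ≤ - (+ suc w)
  ri≤-r = ℤP.neg-mono-≤ (+≤+ (ℕP.m≤m*n (suc w) (suc m)))

exit-above : ∀ {r d} → InWindow r d → ¬ InWindow r (d + + 1) → d + + 1 ≡ r
exit-above {r} {d} (l , u) outside = ℤP.≤-antisym below above
  where
  below : d + + 1 ≤ r
  below = subst (_≤ r) (ℤP.+-comm (+ 1) d) (ℤP.i<j⇒suc[i]≤j u)
  above : r ≤ d + + 1
  above = ℤP.≮⇒≥ (λ d+1<r → outside (ℤP.<-≤-trans l (ℤP.i≤i+j d (+ 1)) , d+1<r))

exit-below : ∀ {r d} → InWindow r d → ¬ InWindow r (d - + 1) → d - + 1 ≡ - r
exit-below {r} {d} (l , u) outside = ℤP.≤-antisym below above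
  where
  below : d - + 1 ≤ - r
  below = ℤP.≮⇒≥ (λ -r<d-1 → outside (-r<d-1 , ℤP.≤-<-trans (ℤP.i-j≤i d (+ 1)) u))
  pred-succ : ∀ (x : ℤ) → + 1 + x - + 1 ≡ x
  pred-succ = solve-∀
  above : - r ≤ d - + 1
  above = subst (_≤ d - + 1) (pred-succ (- r)) (ℤP.+-monoˡ-≤ (- (+ 1)) (ℤP.i<j⇒suc[i]≤j l))

window-complement : ∀ {r s} → InWindow r s → + 0 < r - s × r - s < r + r
window-complement {r} {s} (l , u) =
  subst (_< r - s) (ℤP.+-inverseʳ r) (ℤP.+-monoʳ-< r (ℤP.neg-mono-< u)) ,
  ℤP.+-monoʳ-< r (proj₂ (window-neg (l , u)))

-- The method of images for the band -K < z < K, K = k' + 1.  A pair of words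
-- is tracked by the numbers a, b of letters 1 still to be placed in u, v and by
-- the current value d of the difference walk d + Σ_{j ≤ s} (u_j - v_j).
-- Reflection in the wall z = K sends (a, b, d) to (b + K - d, a - K + d, ·);
-- the two walls together generate the translations (a, b) ↦ (a - 2Kj, b + 2Kj).
module Images (k' : ℕ) where

  K K₂ K₄ : ℤ
  K = + suc k'
  K₂ = K + K
  K₄ = K₂ + K₂

  InBand : ℤ → Set
  InBand = InWindow K

  -- Composing the two reflections translates the difference walk by 4K; on
  -- (a, b) the j-th translate moves by ∓2Kj.
  shift : ℤ → ℤ
  shift j = K₂ * j

  shift-≥ : ∀ m → + m ≤ shift (+ m)
  shift-≥ m = subst (+ m ≤_) (ℤP.pos-* (suc k' ℕ.+ suc k') m) (+≤+ (ℕP.m≤n*m m (suc k' ℕ.+ suc k')))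

  direct : ℕ → ℤ → ℤ → ℤ → ℤ
  direct n a b j = T n (a - shift j) (b + shift j)

  imageTerm : ℕ → ℤ → ℤ → ℤ → ℤ → ℤ
  imageTerm n a b d j = direct n a b j - direct n (b + K - d) (a - K + d) j

  imageSum : ℕ → ℕ → ℤ → ℤ → ℤ → ℤ
  imageSum R n a b d = symΣ R (imageTerm n a b d)

  direct-pascal : ∀ n a b j → direct (suc n) a b j ≡ Σ² (λ x y → direct n (a - val x) (b - val y) j)
  direct-pascal n a b j = trans (T-pascal n (a - shift j) (b + shift j))
    (Σ²-cong (λ x y → sym (cong₂ (T n) (swap₁ a (val x) (shift j)) (swap₂ b (val y) (shift j)))))
    where
    swap₁ : ∀ (a v s : ℤ) → (a - v) - s ≡ (a - s) - v
    swap₁ = solve-∀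
    swap₂ : ∀ (b v s : ℤ) → (b - v) + s ≡ (b + s) - v
    swap₂ = solve-∀

  -- Every image term satisfies the recursion of the count: taking first letters
  -- x, y moves the mirror image of (a, b, d) to that of (a - x, b - y, d + x - y).
  imageTerm-pascal : ∀ n a b d j → imageTerm (suc n) a b d j ≡
    Σ² (λ x y → imageTerm n (a - val x) (b - val y) (d + (val x - val y)) j)
  imageTerm-pascal n a b d j = begin
      direct (suc n) a b j - direct (suc n) (b + K - d) (a - K + d) j
    ≡⟨ cong₂ _-_ (direct-pascal n a b j) (direct-pascal n (b + K - d) (a - K + d) j) ⟩
      Σ² (λ x y → direct n (a - val x) (b - val y) j) - Σ² (λ x y → direct n (b + K - d - val x) (a - K + d - val y) j)
    ≡⟨ Σ²-- (λ x y → direct n (a - val x) (b - val y) j) (λ x y → direct n (b + K - d - val x) (a - K + d - val y) j) ⟩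
      Σ² (λ x y → direct n (a - val x) (b - val y) j - direct n (b + K - d - val x) (a - K + d - val y) j)
    ≡⟨ Σ²-cong (λ x y → cong (λ z → direct n (a - val x) (b - val y) j - z)
         (sym (cong₂ (λ p q → direct n p q j) (mirror₁ b K d (val x) (val y)) (mirror₂ a K d (val x) (val y))))) ⟩
      Σ² (λ x y → imageTerm n (a - val x) (b - val y) (d + (val x - val y)) j) ∎
    where
    open ≡-Reasoning
    mirror₁ : ∀ (b K d vx vy : ℤ) → (b - vy) + K - (d + (vx - vy)) ≡ b + K - d - vx
    mirror₁ = solve-∀
    mirror₂ : ∀ (a K d vx vy : ℤ) → (a - vx) - K + (d + (vx - vy)) ≡ a - K + d - vy
    mirror₂ = solve-∀

  imageSum-pascal : ∀ R n a b d → imageSum R (suc n) a b d ≡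
    Σ² (λ x y → imageSum R n (a - val x) (b - val y) (d + (val x - val y)))
  imageSum-pascal R n a b d = trans (symΣ-cong R (imageTerm-pascal n a b d))
    (symΣ-Σ² R (λ x y → imageTerm n (a - val x) (b - val y) (d + (val x - val y))))

  imageSum-cancel : ∀ R n a b d (σ : ℤ → ℤ) →
    (∀ j → direct n (b + K - d) (a - K + d) j ≡ direct n a b (σ j)) →
    symΣ R (λ j → direct n a b (σ j)) ≡ symΣ R (direct n a b) → imageSum R n a b d ≡ + 0
  imageSum-cancel R n a b d σ mirror preserve = begin
      symΣ R (imageTerm n a b d)
    ≡⟨ symΣ-cong R (λ j → cong (λ z → direct n a b j - z) (mirror j)) ⟩
      symΣ R (λ j → direct n a b j - direct n a b (σ j))
    ≡⟨ symΣ-- R (direct n a b) (λ j → direct n a b (σ j)) ⟩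
      symΣ R (direct n a b) - symΣ R (λ j → direct n a b (σ j))
    ≡⟨ cong (λ z → symΣ R (direct n a b) - z) preserve ⟩
      symΣ R (direct n a b) - symΣ R (direct n a b)
    ≡⟨ ℤP.+-inverseʳ (symΣ R (direct n a b)) ⟩
      + 0 ∎
    where open ≡-Reasoning

  -- On the upper wall d = K the mirror image is the translate by -j.
  imageSum-upper-wall : ∀ R n a b → imageSum R n a b K ≡ + 0
  imageSum-upper-wall R n a b = imageSum-cancel R n a b K -_
    (λ j → trans (cong₂ (T n) (mirror₁ b K j) (mirror₂ a K j)) (T-comm n (b + shift (- j)) (a - shift (- j))))
    (symΣ-reflect R (direct n a b))
    where
    mirror₁ : ∀ (b K j : ℤ) → b + K - K - (K + K) * j ≡ b + (K + K) * (- j)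
    mirror₁ = solve-∀
    mirror₂ : ∀ (a K j : ℤ) → a - K + K + (K + K) * j ≡ a - (K + K) * (- j)
    mirror₂ = solve-∀

  direct-left : ∀ R n a b → b < + R → direct n a b (- (+ R)) ≡ + 0
  direct-left R n a b b<R = T-negʳ n (a - shift (- (+ R))) (b + shift (- (+ R)))
    (subst (_< + 0) (sym (reflected K₂ b (+ R))) (sub-neg (ℤP.<-≤-trans b<R (shift-≥ R))))
    where
    reflected : ∀ (s b r : ℤ) → b + s * (- r) ≡ b - s * r
    reflected = solve-∀

  direct-right : ∀ R n a b → a < + suc R → direct n a b (+ suc R) ≡ + 0
  direct-right R n a b a<R+1 = T-negˡ n (a - shift (+ suc R)) (b + shift (+ suc R))
    (sub-neg (ℤP.<-≤-trans a<R+1 (shift-≥ (suc R))))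

  -- On the lower wall d = -K the mirror image is the translate by 1 - j; the
  -- resulting shift of the index is harmless because a, b < R.
  imageSum-lower-wall : ∀ R n a b → a < + R → b < + R → imageSum R n a b (- K) ≡ + 0
  imageSum-lower-wall R n a b a<R b<R = imageSum-cancel R n a b (- K) (λ j → + 1 - j)
    (λ j → trans (cong₂ (T n) (mirror₁ b K j) (mirror₂ a K j)) (T-comm n (b + shift (+ 1 - j)) (a - shift (+ 1 - j))))
    (begin
      symΣ R (λ j → direct n a b (+ 1 - j))
    ≡⟨ symΣ-reflect R (λ l → direct n a b (+ 1 + l)) ⟩
      symΣ R (λ l → direct n a b (+ 1 + l))
    ≡⟨ symΣ-cong R (λ l → cong (direct n a b) (ℤP.+-comm (+ 1) l)) ⟩
      symΣ R (λ l → direct n a b (l + + 1))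
    ≡⟨ symΣ-shift-invariant R (direct n a b) (direct-left R n a b b<R)
         (direct-right R n a b (ℤP.<-trans a<R (+<+ (ℕP.n<1+n R)))) ⟩
      symΣ R (direct n a b) ∎)
    where
    open ≡-Reasoning
    mirror₁ : ∀ (b K j : ℤ) → b + K - (- K) - (K + K) * j ≡ b + (K + K) * (+ 1 - j)
    mirror₁ = solve-∀
    mirror₂ : ∀ (a K j : ℤ) → a - K + (- K) + (K + K) * j ≡ a - (K + K) * (+ 1 - j)
    mirror₂ = solve-∀

  -- Over the empty word a translate by j ≠ 0 would need a - b = 4Kj, which is
  -- impossible when both ends d and d + (a - b) of the walk lie in the band.
  direct-empty : ∀ a b d j → InBand d → InBand (d + (a - b)) → j ≢ + 0 → direct 0 a b j ≡ + 0
  direct-empty a b d j hd he j≢0 = T-zero _ _ λ α β →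
    j≢0 (multiple-window _ j (subst (InWindow K₄) (difference α β) (window-widen K₂≤K₄ (window-+ he (window-neg hd)))))
    where
    K₂≤K₄ : K₂ ≤ K₄
    K₂≤K₄ = +≤+ (ℕP.m≤m+n _ _)
    regroup : ∀ (d a b K j : ℤ) →
      d + (a - b) + - d ≡ ((K + K) + (K + K)) * j + ((a - (K + K) * j) - (b + (K + K) * j))
    regroup = solve-∀
    difference : a - shift j ≡ + 0 → b + shift j ≡ + 0 → d + (a - b) + - d ≡ K₄ * j
    difference α β = trans (regroup d a b K j)
      (trans (cong₂ (λ p q → K₄ * j + (p - q)) α β) (ℤP.+-identityʳ (K₄ * j)))

  -- Over the empty word no translate of the mirror image counts: it would need
  -- d + (d + (a - b)) = 2K - 4Kj, but this sum lies in (-2K, 2K).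
  mirror-empty : ∀ a b d j → InBand d → InBand (d + (a - b)) → direct 0 (b + K - d) (a - K + d) j ≡ + 0
  mirror-empty a b d j hd he = T-zero _ _ λ γ δ → ℤP.<-irrefl refl
    (subst (+ 0 <_) (trans (sym (difference γ δ)) (trans (cong (λ i → K₄ * i) (j≡0 γ δ)) (ℤP.*-zeroʳ K₄))) positive)
    where
    s = d + (a - b) + d
    positive : + 0 < K₂ - s
    positive = proj₁ (window-complement (window-+ he hd))
    regroup : ∀ (d a b K j : ℤ) → ((K + K) + (K + K)) * j ≡
      ((K + K) - (d + (a - b) + d)) + ((a - K + d + (K + K) * j) - (b + K - d - (K + K) * j))
    regroup = solve-∀
    difference : b + K - d - shift j ≡ + 0 → a - K + d + shift j ≡ + 0 → K₄ * j ≡ K₂ - s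
    difference γ δ = trans (regroup d a b K j)
      (trans (cong₂ (λ p q → (K₂ - s) + (p - q)) δ γ) (ℤP.+-identityʳ (K₂ - s)))
    j≡0 : b + K - d - shift j ≡ + 0 → a - K + d + shift j ≡ + 0 → j ≡ + 0
    j≡0 γ δ = multiple-window _ j (subst (InWindow K₄) (sym (difference γ δ))
      (ℤP.<-trans -<+ positive , proj₂ (window-complement (window-+ he hd))))

  imageSum-empty : ∀ R a b d → InBand d → InBand (d + (a - b)) → imageSum R 0 a b d ≡ T 0 a b
  imageSum-empty R a b d hd he = begin
      symΣ R (imageTerm 0 a b d)
    ≡⟨ symΣ-support R (imageTerm 0 a b d) z≤n
         (λ m _ → vanish -[1+ m ] (λ ())) (λ m _ → vanish (+ suc m) (λ ())) ⟩
      direct 0 a b (+ 0) - direct 0 (b + K - d) (a - K + d) (+ 0)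
    ≡⟨ cong₂ _-_ (cong₂ (T 0) (trans (cong (λ z → a - z) shift0) (ℤP.+-identityʳ a))
                              (trans (cong (λ z → b + z) shift0) (ℤP.+-identityʳ b)))
                 (mirror-empty a b d (+ 0) hd he) ⟩
      T 0 a b - + 0
    ≡⟨ ℤP.+-identityʳ (T 0 a b) ⟩
      T 0 a b ∎
    where
    open ≡-Reasoning
    shift0 : shift (+ 0) ≡ + 0
    shift0 = ℤP.*-zeroʳ K₂
    vanish : ∀ j → j ≢ + 0 → imageTerm 0 a b d j ≡ + 0
    vanish j j≢0 = cong₂ _-_ (direct-empty a b d j hd he j≢0) (mirror-empty a b d j hd he)

ΣL : {A : Set} → (A → ℤ) → List A → ℤ
ΣL f [] = + 0
ΣL f (x ∷ xs) = f x + ΣL f xs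

ΣL-cong : {A : Set} (xs : List A) {f g : A → ℤ} → (∀ x → f x ≡ g x) → ΣL f xs ≡ ΣL g xs
ΣL-cong [] eq = refl
ΣL-cong (x ∷ xs) eq = cong₂ _+_ (eq x) (ΣL-cong xs eq)

ΣL-+ : {A : Set} (xs : List A) (f g : A → ℤ) → ΣL (λ x → f x + g x) xs ≡ ΣL f xs + ΣL g xs
ΣL-+ [] f g = refl
ΣL-+ (x ∷ xs) f g =
  trans (cong (λ s → f x + g x + s) (ΣL-+ xs f g)) (regroup (f x) (g x) (ΣL f xs) (ΣL g xs))
  where
  regroup : ∀ (a b c d : ℤ) → a + b + (c + d) ≡ a + c + (b + d)
  regroup = solve-∀

ΣL-scale : {A : Set} (xs : List A) (c : ℤ) (f : A → ℤ) → ΣL (λ x → c * f x) xs ≡ c * ΣL f xs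
ΣL-scale [] c f = sym (ℤP.*-zeroʳ c)
ΣL-scale (x ∷ xs) c f =
  trans (cong (λ s → c * f x + s) (ΣL-scale xs c f)) (sym (ℤP.*-distribˡ-+ c (f x) (ΣL f xs)))

ΣL-++ : {A : Set} (xs ys : List A) (f : A → ℤ) → ΣL f (xs ++ ys) ≡ ΣL f xs + ΣL f ys
ΣL-++ [] ys f = sym (ℤP.+-identityˡ (ΣL f ys))
ΣL-++ (x ∷ xs) ys f =
  trans (cong (λ s → f x + s) (ΣL-++ xs ys f)) (sym (ℤP.+-assoc (f x) (ΣL f xs) (ΣL f ys)))

ΣL-map : {A B : Set} (xs : List A) (g : A → B) (f : B → ℤ) → ΣL f (map g xs) ≡ ΣL (λ x → f (g x)) xs
ΣL-map [] g f = refl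
ΣL-map (x ∷ xs) g f = cong (λ s → f (g x) + s) (ΣL-map xs g f)

ΣL-cartesianProduct : {A B : Set} (xs : List A) (ys : List B) (f : A × B → ℤ) →
  ΣL f (cartesianProduct xs ys) ≡ ΣL (λ x → ΣL (λ y → f (x , y)) ys) xs
ΣL-cartesianProduct [] ys f = refl
ΣL-cartesianProduct (x ∷ xs) ys f = trans (ΣL-++ (map (x ,_) ys) _ f)
  (cong₂ _+_ (ΣL-map ys (x ,_) f) (ΣL-cartesianProduct xs ys f))

ΣL-filter : {A : Set} {P : A → Set} (P? : Decidable P) (xs : List A) (f : A → ℤ) →
  ΣL f (filter P? xs) ≡ ΣL (λ x → 𝟙 (P? x) * f x) xs
ΣL-filter P? [] f = refl
ΣL-filter P? (x ∷ xs) f with P? x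
... | yes _ = cong₂ _+_ (sym (ℤP.*-identityˡ (f x))) (ΣL-filter P? xs f)
... | no _ = trans (ΣL-filter P? xs f) (sym (ℤP.+-identityˡ _))

length-filter : {A : Set} {P : A → Set} (P? : Decidable P) (xs : List A) →
  + length (filter P? xs) ≡ ΣL (λ x → 𝟙 (P? x)) xs
length-filter P? [] = refl
length-filter P? (x ∷ xs) with P? x
... | yes _ = cong (λ s → + 1 + s) (length-filter P? xs)
... | no _ = trans (length-filter P? xs) (sym (ℤP.+-identityˡ _))

ΣL-allWords : ∀ n (f : Word → ℤ) → ΣL f (allWords (suc n)) ≡ ΣL (λ u → f (false ∷ u) + f (true ∷ u)) (allWords n)
ΣL-allWords n f = go (allWords n)
  where
  go : (ws : List Word) →
    ΣL f (concatMap (λ w → (false ∷ w) ∷ (true ∷ w) ∷ []) ws) ≡ ΣL (λ u → f (false ∷ u) + f (true ∷ u)) ws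
  go [] = refl
  go (w ∷ ws) = trans (cong (λ s → f (false ∷ w) + (f (true ∷ w) + s)) (go ws))
    (sym (ℤP.+-assoc (f (false ∷ w)) (f (true ∷ w)) _))

ΣL-allWords-cong : ∀ n {f g : Word → ℤ} → (∀ u → ones u ℕ.+ zeros u ≡ n → f u ≡ g u) →
  ΣL f (allWords n) ≡ ΣL g (allWords n)
ΣL-allWords-cong zero eq = cong (_+ + 0) (eq [] refl)
ΣL-allWords-cong (suc n) {f} {g} eq = begin
    ΣL f (allWords (suc n))
  ≡⟨ ΣL-allWords n f ⟩
    ΣL (λ u → f (false ∷ u) + f (true ∷ u)) (allWords n)
  ≡⟨ ΣL-allWords-cong n (λ u len → cong₂ _+_
       (eq (false ∷ u) (trans (ℕP.+-suc (ones u) (zeros u)) (cong suc len)))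
       (eq (true ∷ u) (cong suc len))) ⟩
    ΣL (λ u → g (false ∷ u) + g (true ∷ u)) (allWords n)
  ≡⟨ sym (ΣL-allWords n g) ⟩
    ΣL g (allWords (suc n)) ∎
  where open ≡-Reasoning

ΣL-allWords² : ∀ n (H : Word → Word → ℤ) →
  ΣL (λ u → ΣL (H u) (allWords (suc n))) (allWords (suc n)) ≡
  Σ² (λ x y → ΣL (λ u → ΣL (λ v → H (x ∷ u) (y ∷ v)) (allWords n)) (allWords n))
ΣL-allWords² n H = begin
    ΣL (λ u → ΣL (H u) (allWords (suc n))) (allWords (suc n))
  ≡⟨ ΣL-allWords n _ ⟩
    ΣL (λ u → ΣL (H (false ∷ u)) W₊ + ΣL (H (true ∷ u)) W₊) Wₙ
  ≡⟨ ΣL-cong Wₙ (λ u → cong₂ _+_ (ΣL-allWords n (H (false ∷ u))) (ΣL-allWords n (H (true ∷ u)))) ⟩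
    ΣL (λ u → ΣL (λ v → h false false u v + h false true u v) Wₙ
            + ΣL (λ v → h true false u v + h true true u v) Wₙ) Wₙ
  ≡⟨ ΣL-cong Wₙ (λ u → cong₂ _+_ (ΣL-+ Wₙ (h false false u) (h false true u))
                                 (ΣL-+ Wₙ (h true false u) (h true true u))) ⟩
    ΣL (λ u → (S false false u + S false true u) + (S true false u + S true true u)) Wₙ
  ≡⟨ ΣL-+ Wₙ _ _ ⟩
    ΣL (λ u → S false false u + S false true u) Wₙ + ΣL (λ u → S true false u + S true true u) Wₙ
  ≡⟨ cong₂ _+_ (ΣL-+ Wₙ (S false false) (S false true)) (ΣL-+ Wₙ (S true false) (S true true)) ⟩
    Σ² (λ x y → ΣL (S x y) Wₙ) ∎
  where
  open ≡-Reasoning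
  Wₙ = allWords n
  W₊ = allWords (suc n)
  h : Bool → Bool → Word → Word → ℤ
  h x y u v = H (x ∷ u) (y ∷ v)
  S : Bool → Bool → Word → ℤ
  S x y u = ΣL (h x y u) Wₙ

applyUpTo-suc : ∀ n → applyUpTo suc n ≡ map suc (upTo n)
applyUpTo-suc n = go (λ i → i) n
  where
  go : ∀ (g : ℕ → ℕ) n → applyUpTo (λ i → suc (g i)) n ≡ map suc (applyUpTo g n)
  go g zero = refl
  go g (suc n) = cong (suc (g 0) ∷_) (go (λ i → g (suc i)) n)

ones-∷ : ∀ x u → + ones (x ∷ u) ≡ + ones u + val x
ones-∷ true u = ℤP.+-comm (+ 1) (+ ones u)
ones-∷ false u = sym (ℤP.+-identityʳ (+ ones u))

𝟙-ones-∷ : ∀ x u a → 𝟙 (+ ones (x ∷ u) ℤ.≟ a) ≡ 𝟙 (+ ones u ℤ.≟ a - val x)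
𝟙-ones-∷ x u a = 𝟙-cong
  (λ eq → trans (sym (cancel (+ ones u) (val x))) (cong (_- val x) (trans (sym (ones-∷ x u)) eq)))
  (λ eq → trans (ones-∷ x u) (trans (cong (_+ val x) eq) (uncancel a (val x))))
  (+ ones (x ∷ u) ℤ.≟ a) (+ ones u ℤ.≟ a - val x)
  where
  cancel : ∀ (o v : ℤ) → (o + v) - v ≡ o
  cancel = solve-∀
  uncancel : ∀ (a v : ℤ) → (a - v) + v ≡ a
  uncancel = solve-∀

module Counting (k' : ℕ) where
  open Images k' using (K; InBand)

  inBand? : (z : ℤ) → Dec (InBand z)
  inBand? z = (- K <? z) ×-dec (z <? K)

  StaysInBand : ℤ → ℕ → Word → Word → Set
  StaysInBand d n u v = All (λ s → InBand (d + D u v s)) (map suc (upTo n))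

  staysInBand? : ∀ d n u v → Dec (StaysInBand d n u v)
  staysInBand? d n u v = all? (λ s → inBand? (d + D u v s)) (map suc (upTo n))

  stays-∷ : ∀ d n x y u v → let d' = d + (val x - val y) in
    StaysInBand d (suc n) (x ∷ u) (y ∷ v) ⇔ (InBand d' × StaysInBand d' n u v)
  stays-∷ d n x y u v = mk⇔
    (λ { (first ∷ rest) →
      subst InBand (cong (λ z → d + z) (ℤP.+-identityʳ step)) first ,
      All.map (λ {s} p → subst InBand (sym (ℤP.+-assoc d step (D u v s))) p)
        (AllP.map⁻ (subst (λ l → All _ (map suc l)) (applyUpTo-suc n) rest)) })
    (λ { (first , rest) →
      subst InBand (sym (cong (λ z → d + z) (ℤP.+-identityʳ step))) first ∷
      subst (λ l → All _ (map suc l)) (sym (applyUpTo-suc n))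
        (AllP.map⁺ (All.map (λ {s} p → subst InBand (ℤP.+-assoc d step (D u v s)) p) rest)) })
    where
    step = val x - val y

  admissible : ℕ → ℤ → ℤ → ℤ → Word → Word → ℤ
  admissible n a b d u v = 𝟙 (+ ones u ℤ.≟ a) * (𝟙 (+ ones v ℤ.≟ b) * 𝟙 (staysInBand? d n u v))

  pairCount : ℕ → ℤ → ℤ → ℤ → ℤ
  pairCount n a b d = ΣL (λ u → ΣL (admissible n a b d u) (allWords n)) (allWords n)

  admissible-∷ : ∀ n a b d x y u v → let d' = d + (val x - val y) in
    admissible (suc n) a b d (x ∷ u) (y ∷ v) ≡ 𝟙 (inBand? d') * admissible n (a - val x) (b - val y) d' u v
  admissible-∷ n a b d x y u v = begin
      𝟙 (+ ones (x ∷ u) ℤ.≟ a) * (𝟙 (+ ones (y ∷ v) ℤ.≟ b) * 𝟙 (staysInBand? d (suc n) (x ∷ u) (y ∷ v)))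
    ≡⟨ cong₂ (λ p q → p * (q * 𝟙 (staysInBand? d (suc n) (x ∷ u) (y ∷ v)))) (𝟙-ones-∷ x u a) (𝟙-ones-∷ y v b) ⟩
      A * (B * 𝟙 (staysInBand? d (suc n) (x ∷ u) (y ∷ v)))
    ≡⟨ cong (λ z → A * (B * z)) (trans
         (𝟙-cong (Equivalence.to (stays-∷ d n x y u v)) (Equivalence.from (stays-∷ d n x y u v))
                 (staysInBand? d (suc n) (x ∷ u) (y ∷ v)) (inBand? d' ×-dec staysInBand? d' n u v))
         (𝟙-× (inBand? d') (staysInBand? d' n u v))) ⟩
      A * (B * (𝟙 (inBand? d') * 𝟙 (staysInBand? d' n u v)))
    ≡⟨ regroup A B (𝟙 (inBand? d')) (𝟙 (staysInBand? d' n u v)) ⟩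
      𝟙 (inBand? d') * (A * (B * 𝟙 (staysInBand? d' n u v))) ∎
    where
    open ≡-Reasoning
    d' = d + (val x - val y)
    A = 𝟙 (+ ones u ℤ.≟ a - val x)
    B = 𝟙 (+ ones v ℤ.≟ b - val y)
    regroup : ∀ (a b c e : ℤ) → a * (b * (c * e)) ≡ c * (a * (b * e))
    regroup = solve-∀

  pairCount-step : ∀ n a b d → pairCount (suc n) a b d ≡
    Σ² (λ x y → 𝟙 (inBand? (d + (val x - val y))) * pairCount n (a - val x) (b - val y) (d + (val x - val y)))
  pairCount-step n a b d = trans (ΣL-allWords² n (admissible (suc n) a b d)) (Σ²-cong λ x y →
    trans (ΣL-cong Wₙ (λ u → trans (ΣL-cong Wₙ (admissible-∷ n a b d x y u))
                                   (ΣL-scale Wₙ (c x y) (admissible n (a - val x) (b - val y) (d + (val x - val y)) u))))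
          (ΣL-scale Wₙ (c x y) _))
    where
    Wₙ = allWords n
    c : Bool → Bool → ℤ
    c x y = 𝟙 (inBand? (d + (val x - val y)))

  countPairs≡pairCount : ∀ M N → + countPairs M N (suc k') ≡ pairCount (M ℕ.+ N) (+ M) (+ M) (+ 0)
  countPairs≡pairCount M N = begin
      + countPairs M N (suc k')
    ≡⟨ length-filter (bounded? n (suc k')) (cartesianProduct WW WW) ⟩
      ΣL (λ p → 𝟙 (bounded? n (suc k') p)) (cartesianProduct WW WW)
    ≡⟨ ΣL-cartesianProduct WW WW (λ p → 𝟙 (bounded? n (suc k') p)) ⟩
      ΣL (λ u → ΣL (λ v → β u v) WW) WW
    ≡⟨ ΣL-filter shape? (allWords n) (λ u → ΣL (λ v → β u v) WW) ⟩
      ΣL (λ u → 𝟙 (shape? u) * ΣL (λ v → β u v) WW) (allWords n)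
    ≡⟨ ΣL-cong (allWords n) (λ u → cong (λ z → 𝟙 (shape? u) * z) (ΣL-filter shape? (allWords n) (β u))) ⟩
      ΣL (λ u → 𝟙 (shape? u) * ΣL (λ v → 𝟙 (shape? v) * β u v) (allWords n)) (allWords n)
    ≡⟨ ΣL-allWords-cong n (λ u len-u → cong₂ _*_ (𝟙-shape u len-u)
         (ΣL-allWords-cong n (λ v len-v → cong₂ _*_ (𝟙-shape v len-v) (𝟙-bounded u v)))) ⟩
      ΣL (λ u → 𝟙 (+ ones u ℤ.≟ + M)
              * ΣL (λ v → 𝟙 (+ ones v ℤ.≟ + M) * 𝟙 (staysInBand? (+ 0) n u v)) (allWords n)) (allWords n)
    ≡⟨ sym (ΣL-cong (allWords n) (λ u → ΣL-scale (allWords n) (𝟙 (+ ones u ℤ.≟ + M)) _)) ⟩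
      pairCount n (+ M) (+ M) (+ 0) ∎
    where
    open ≡-Reasoning
    n = M ℕ.+ N
    WW = wordsWith M N
    β : Word → Word → ℤ
    β u v = 𝟙 (bounded? n (suc k') (u , v))
    shape? : (w : Word) → Dec (ones w ≡ M × zeros w ≡ N)
    shape? w = (ones w ℕ.≟ M) ×-dec (zeros w ℕ.≟ N)
    -- For a word of length M + N, having N letters 0 follows from having M letters 1.
    𝟙-shape : ∀ u → ones u ℕ.+ zeros u ≡ n → 𝟙 (shape? u) ≡ 𝟙 (+ ones u ℤ.≟ + M)
    𝟙-shape u len = 𝟙-cong (λ eq → cong +_ (proj₁ eq))
      (λ eq → ℤP.+-injective eq ,
              ℕP.+-cancelˡ-≡ M (zeros u) N (trans (cong (ℕ._+ zeros u) (sym (ℤP.+-injective eq))) len))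
      (shape? u) (+ ones u ℤ.≟ + M)
    𝟙-bounded : ∀ u v → β u v ≡ 𝟙 (staysInBand? (+ 0) n u v)
    𝟙-bounded u v = 𝟙-cong
      (All.map (λ {s} p → subst InBand (sym (ℤP.+-identityˡ (D u v s))) p))
      (All.map (λ {s} p → subst InBand (ℤP.+-identityˡ (D u v s)) p))
      (bounded? n (suc k') (u , v)) (staysInBand? (+ 0) n u v)

letter-≤ : ∀ x a → a - val x ≤ a
letter-≤ true a = ℤP.i-j≤i a (+ 1)
letter-≤ false a = ℤP.i-j≤i a (+ 0)

module Reflection (k' : ℕ) where
  open Images k'
  open Counting k'

  pairCount-empty : ∀ a b d → pairCount 0 a b d ≡ T 0 a b
  pairCount-empty a b d = trans (regroup (𝟙 (+ 0 ℤ.≟ a)) (𝟙 (+ 0 ℤ.≟ b)))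
                                (sym (cong₂ _*_ (binomℤ-zero a) (binomℤ-zero b)))
    where
    regroup : ∀ (x y : ℤ) → (x * (y * + 1) + + 0) + + 0 ≡ x * y
    regroup = solve-∀

  -- A first step that leaves the band lands on one of the walls, where the image sum vanishes.
  leave-band : ∀ R n a b d → InBand d → a < + R → b < + R → ∀ x y → ¬ InBand (d + (val x - val y)) →
    imageSum R n (a - val x) (b - val y) (d + (val x - val y)) ≡ + 0
  leave-band R n a b d hd a<R b<R false false out = ⊥-elim (out (subst InBand (sym (ℤP.+-identityʳ d)) hd))
  leave-band R n a b d hd a<R b<R true true out = ⊥-elim (out (subst InBand (sym (ℤP.+-identityʳ d)) hd))
  leave-band R n a b d hd a<R b<R true false out =
    trans (cong (imageSum R n (a - + 1) (b - + 0)) (exit-above hd out)) (imageSum-upper-wall R n (a - + 1) (b - + 0))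
  leave-band R n a b d hd a<R b<R false true out =
    trans (cong (imageSum R n (a - + 0) (b - + 1)) (exit-below hd out))
          (imageSum-lower-wall R n (a - + 0) (b - + 1)
            (ℤP.≤-<-trans (letter-≤ false a) a<R) (ℤP.≤-<-trans (letter-≤ true b) b<R))

  -- Induction on n: both sides satisfy the same recursion; a first step that
  -- stays in the band keeps the hypotheses, one that leaves it lands on a wall.
  pairCount≡imageSum : ∀ R n a b d → InBand d → InBand (d + (a - b)) → a < + R → b < + R →
    pairCount n a b d ≡ imageSum R n a b d
  pairCount≡imageSum R zero a b d hd he a<R b<R =
    trans (pairCount-empty a b d) (sym (imageSum-empty R a b d hd he))
  pairCount≡imageSum R (suc n) a b d hd he a<R b<R =
    trans (pairCount-step n a b d) (trans (Σ²-cong first-step) (sym (imageSum-pascal R n a b d)))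
    where
    end : ∀ (d a b vx vy : ℤ) → d + (a - b) ≡ d + (vx - vy) + ((a - vx) - (b - vy))
    end = solve-∀
    first-step' : ∀ x y → (p : Dec (InBand (d + (val x - val y)))) →
      𝟙 p * pairCount n (a - val x) (b - val y) (d + (val x - val y)) ≡
      imageSum R n (a - val x) (b - val y) (d + (val x - val y))
    first-step' x y (yes inside) = trans (ℤP.*-identityˡ _)
      (pairCount≡imageSum R n (a - val x) (b - val y) (d + (val x - val y)) inside
        (subst InBand (end d a b (val x) (val y)) he)
        (ℤP.≤-<-trans (letter-≤ x a) a<R) (ℤP.≤-<-trans (letter-≤ y b) b<R))
    first-step' x y (no outside) = sym (leave-band R n a b d hd a<R b<R x y outside)
    first-step : ∀ x y → 𝟙 (inBand? (d + (val x - val y))) * pairCount n (a - val x) (b - val y) (d + (val x - val y)) ≡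
      imageSum R n (a - val x) (b - val y) (d + (val x - val y))
    first-step x y = first-step' x y (inBand? (d + (val x - val y)))

minus-one-^-even : ∀ m → (- (+ 1)) ℤ.^ (m ℕ.+ m) ≡ + 1
minus-one-^-even zero = refl
minus-one-^-even (suc m) rewrite ℕP.+-suc m m | minus-one-^-even m = refl

signℤ-even : ∀ j → signℤ (+ 2 * j) ≡ + 1
signℤ-even j = trans
  (cong ((- (+ 1)) ℤ.^_) (trans (ℤP.∣i*j∣≡∣i∣*∣j∣ (+ 2) j) (cong (∣ j ∣ ℕ.+_) (ℕP.+-identityʳ ∣ j ∣))))
                     (minus-one-^-even ∣ j ∣)

signℤ-pred : ∀ l → signℤ (l - + 1) ≡ - signℤ l
signℤ-pred (+ zero) = refl
signℤ-pred (+ suc m) = flip ((- (+ 1)) ℤ.^ m)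
  where
  flip : ∀ (x : ℤ) → x ≡ - (- (+ 1) * x)
  flip = solve-∀
signℤ-pred -[1+ m ] rewrite ℕP.+-identityʳ m = flip ((- (+ 1)) ℤ.^ m)
  where
  flip : ∀ (x : ℤ) → - (+ 1) * (- (+ 1) * x) ≡ - (- (+ 1) * x)
  flip = solve-∀

binomℤ-complement : ∀ M N z → binomℤ (M ℕ.+ N) (+ N - z) ≡ binomℤ (M ℕ.+ N) (+ M + z)
binomℤ-complement M N z =
  trans (cong (binomℤ (M ℕ.+ N)) (sym (regroup (+ M) (+ N) z))) (binomℤ-reflect (M ℕ.+ N) (+ M + z))
  where
  regroup : ∀ (m n z : ℤ) → (m + n) - (m + z) ≡ n - z
  regroup = solve-∀

module Evaluation (k' : ℕ) (M N : ℕ) where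
  open Images k'

  n = M ℕ.+ N

  g : ℤ → ℤ
  g = term M N (suc k')

  term-vanish⁺ : ∀ m → M ℕ.≤ m → g (+ suc m) ≡ + 0
  term-vanish⁺ m M≤m = cong (λ z → z * binomℤ n (+ N - K * + suc m) * signℤ (+ suc m))
    (binomℤ-neg n (+ M - K * + suc m) (sub-neg (ℤP.<-≤-trans (+<+ (s≤s M≤m)) (+≤+ (ℕP.m≤n*m (suc m) (suc k'))))))

  -- For negative l use C(n, N - Kl) = C(n, M + Kl) = C(n, M - K|l|).
  term-vanish⁻ : ∀ m → M ℕ.≤ m → g -[1+ m ] ≡ + 0
  term-vanish⁻ m M≤m = trans
    (cong (λ z → binomℤ n (+ M - K * -[1+ m ]) * z * signℤ -[1+ m ])
      (trans (binomℤ-complement M N (K * -[1+ m ])) (trans (cong (binomℤ n) (regroup K (+ M) (+ suc m)))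
        (binomℤ-neg n (+ M - K * + suc m) (sub-neg (ℤP.<-≤-trans (+<+ (s≤s M≤m)) (+≤+ (ℕP.m≤n*m (suc m) (suc k')))))))))
    (cong (_* signℤ -[1+ m ]) (ℤP.*-zeroʳ (binomℤ n (+ M - K * -[1+ m ]))))
    where
    regroup : ∀ (K m x : ℤ) → m + K * (- x) ≡ m - K * x
    regroup = solve-∀

  imageTerm-origin : ∀ j → imageTerm n (+ M) (+ M) (+ 0) j ≡ g (+ 2 * j) + g (+ 2 * j - + 1)
  imageTerm-origin j = sym (begin
      g (+ 2 * j) + g (+ 2 * j - + 1)
    ≡⟨ cong₂ _+_ (cong₂ (λ p q → p * q * signℤ (+ 2 * j))
           (cong (binomℤ n) (even₁ K j (+ M)))
           (trans (binomℤ-complement M N (K * (+ 2 * j))) (cong (binomℤ n) (even₂ K j (+ M)))))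
         (cong₂ (λ p q → p * q * signℤ (+ 2 * j - + 1))
           (cong (binomℤ n) (odd₁ K j (+ M)))
           (trans (binomℤ-complement M N (K * (+ 2 * j - + 1))) (cong (binomℤ n) (odd₂ K j (+ M))))) ⟩
      T n (+ M - shift j) (+ M + shift j) * signℤ (+ 2 * j) + T n image₁ image₂ * signℤ (+ 2 * j - + 1)
    ≡⟨ cong₂ (λ p q → T n (+ M - shift j) (+ M + shift j) * p + T n image₁ image₂ * q)
         (signℤ-even j) (trans (signℤ-pred (+ 2 * j)) (cong -_ (signℤ-even j))) ⟩
      T n (+ M - shift j) (+ M + shift j) * + 1 + T n image₁ image₂ * - (+ 1)
    ≡⟨ signs (T n (+ M - shift j) (+ M + shift j)) (T n image₁ image₂) ⟩
      imageTerm n (+ M) (+ M) (+ 0) j ∎)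
    where
    open ≡-Reasoning
    image₁ = + M + K - + 0 - shift j
    image₂ = + M - K + + 0 + shift j
    even₁ : ∀ (K j m : ℤ) → m - K * (+ 2 * j) ≡ m - (K + K) * j
    even₁ = solve-∀
    even₂ : ∀ (K j m : ℤ) → m + K * (+ 2 * j) ≡ m + (K + K) * j
    even₂ = solve-∀
    odd₁ : ∀ (K j m : ℤ) → m - K * (+ 2 * j - + 1) ≡ m + K - + 0 - (K + K) * j
    odd₁ = solve-∀
    odd₂ : ∀ (K j m : ℤ) → m + K * (+ 2 * j - + 1) ≡ m - K + + 0 + (K + K) * j
    odd₂ = solve-∀
    signs : ∀ (x y : ℤ) → x * + 1 + y * - (+ 1) ≡ x - y
    signs = solve-∀

  imageSum-origin : ∀ L → M ℕ.≤ L → imageSum (suc L) n (+ M) (+ M) (+ 0) ≡ symΣ L g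
  imageSum-origin L M≤L = begin
      imageSum R n (+ M) (+ M) (+ 0)
    ≡⟨ symΣ-cong R imageTerm-origin ⟩
      symΣ R pair
    ≡⟨ sym (ℤP.+-identityʳ (symΣ R pair)) ⟩
      symΣ R pair + + 0
    ≡⟨ cong (λ z → symΣ R pair + z) (sym (term-vanish⁺ (R ℕ.+ R) (ℕP.≤-trans M≤L L≤R+R))) ⟩
      symΣ R pair + g (+ suc (R ℕ.+ R))
    ≡⟨ sym (symΣ-pairs R g) ⟩
      symΣ (suc (R ℕ.+ R)) g
    ≡⟨ symΣ-support (suc (R ℕ.+ R)) g (ℕP.≤-trans L≤R+R (ℕP.n≤1+n _))
         (λ m L≤m → term-vanish⁻ m (ℕP.≤-trans M≤L L≤m)) (λ m L≤m → term-vanish⁺ m (ℕP.≤-trans M≤L L≤m)) ⟩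
      symΣ L g ∎
    where
    open ≡-Reasoning
    R = suc L
    L≤R+R : L ℕ.≤ R ℕ.+ R
    L≤R+R = ℕP.≤-trans (ℕP.n≤1+n L) (ℕP.m≤m+n R R)
    pair : ℤ → ℤ
    pair j = g (+ 2 * j) + g (+ 2 * j - + 1)

-- The theorem.
proposition2p2 : (M N k : ℕ) → 1 ℕ.≤ k → (M ∸ N) ⊔ (N ∸ M) ℕ.≤ k →
    (L : ℕ) → M ℕ.+ N ℕ.≤ L →
    + (countPairs M N k) ≡ symSum L (term M N k)
proposition2p2 M N (suc k') _ _ L M+N≤L = begin
    + countPairs M N (suc k')
  ≡⟨ countPairs≡pairCount M N ⟩
    pairCount (M ℕ.+ N) (+ M) (+ M) (+ 0)
  ≡⟨ pairCount≡imageSum (suc L) (M ℕ.+ N) (+ M) (+ M) (+ 0) origin-in-band end-in-band M<R M<R ⟩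
    imageSum (suc L) (M ℕ.+ N) (+ M) (+ M) (+ 0)
  ≡⟨ imageSum-origin L M≤L ⟩
    symΣ L (term M N (suc k'))
  ≡⟨ sym (symSum≡symΣ L (term M N (suc k'))) ⟩
    symSum L (term M N (suc k')) ∎
  where
  open ≡-Reasoning
  open Images k' using (InBand; imageSum)
  open Counting k' using (pairCount; countPairs≡pairCount)
  open Reflection k' using (pairCount≡imageSum)
  open Evaluation k' M N using (imageSum-origin)
  M≤L : M ℕ.≤ L
  M≤L = ℕP.≤-trans (ℕP.m≤m+n M N) M+N≤L
  M<R : + M < + suc L
  M<R = +<+ (s≤s M≤L)
  origin-in-band : InBand (+ 0)
  origin-in-band = -<+ , +<+ (s≤s z≤n)
  diagonal : ∀ (m : ℤ) → + 0 + (m - m) ≡ + 0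
  diagonal = solve-∀
  end-in-band : InBand (+ 0 + (+ M - + M))
  end-in-band = subst InBand (sym (diagonal (+ M))) origin-in-band
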